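{- Let $(E,\mathcal S,c,r,q)$ be a PSMC instance with $|E|=n$, let $0<\varepsilon<1$, and suppose Algorithm 1 (described in the context), run with an $\alpha$-approximation algorithm for MDSC, executes its loop $t$ times, selecting sub-collections $\mathcal R_1,\ldots,\mathcal R_t$ in this order. Let $opt$ be the optimal cost of the PSMC instance. Then $c(\mathcal R_t)\le \alpha\left(1+\frac{1-q}{\varepsilon q}\right)opt$.
   Context: For $\mathcal S'\subseteq\mathcal S$ and $e\in E$, $\mathcal S'_e=\{S\in\mathcal S'\colon e\in S\}$; $e$ is fully covered by $\mathcal S'$ if $|\mathcal S'_e|\ge r_e$; $\mathcal C(\mathcal S')$ is the set of elements fully covered by $\mathcal S'$; $c(\mathcal S')=\sum_{S\in\mathcal S'}c_S$. PSMC: given element set $E$ with $|E|=n$, collection $\mathcal S\subseteq 2^E$, costs $c_S$, positive integer requirements $r_e$, and a constant $0<q<1$, find a minimum-cost $\mathcal S'\subseteq\mathcal S$ with $|\mathcal C(\mathcal S')|\ge qn$. MDSC: given $(E,\mathcal S,c,r)$, find $\mathcal S'\subseteq\mathcal S$ minimizing the density $c(\mathcal S')/|\mathcal C(\mathcal S')|$; an $\alpha$-approximation algorithm for MDSC returns a sub-collection of density at most $\alpha$ times the minimum. Algorithm 1: set $\mathcal F=\emptyset$, $q'=q$; while $q'>\varepsilon q$: run the $\alpha$-approximation algorithm for MDSC on the reduced instance to obtain $\mathcal R$, set $\mathcal F\leftarrow\mathcal F\cup\mathcal R$, and update the reduced instance; output $\mathcal F$. The reduced instance with respect to the current $\mathcal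 F$ is $(E',\mathcal S',c,r',q')$ where $E'=E\setminus\mathcal C(\mathcal F)$, each set has the elements of $\mathcal C(\mathcal F)$ removed, $r'_e=\max\{0,r_e-|\mathcal F_e|\}$, and $q'=(qn-|\mathcal C(\mathcal F)|)/n$. -}

module Defs where

open import Data.Bool using (Bool; true; false; if_then_else_; not; _∧_)
open import Data.Nat as ℕ using (ℕ; zero; suc)
open import Data.Fin using (Fin)
open import Data.Fin.Subset using (Subset; ⊥; _∪_; ∣_∣)
open import Data.Vec using (tabulate; lookup; foldr)
open import Data.Integer using (+_)
open import Data.Rational as ℚ using (ℚ; 0ℚ; _+_; _*_; _-_; _÷_; _/_; _≤_; _<_)
open import Relation.Nullary using (does; ¬_)
open import Data.Product using (Σ; _×_)

⟦_⟧ : ℕ → ℚ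
⟦ k ⟧ = + k / 1

SetSystem : ℕ → ℕ → Set
SetSystem n m = Fin m → Subset n

mult : ∀ {n m} → SetSystem n m → Subset m → Fin n → ℕ
mult S F e = ∣ tabulate (λ j → lookup F j ∧ lookup (S j) e) ∣

covered : ∀ {n m} → SetSystem n m → (Fin n → ℕ) → Subset m → Subset n
covered S r F = tabulate (λ e → does (r e ℕ.≤? mult S F e))

cost : ∀ {m} → (Fin m → ℚ) → Subset m → ℚ
cost c F = foldr _ _+_ 0ℚ (tabulate (λ j → if lookup F j then c j else 0ℚ))

density : ℚ → (k : ℕ) → .{{ℕ.NonZero k}} → ℚ
density x k = x * (+ 1 / k)

-- Reduced instance w.r.t. the current collection F:
--   E' = E ∖ 𝒞(F); each set has the elements of 𝒞(F) removed;
--   r'_e = max{0, r_e − |F_e|}  (truncated subtraction on ℕ).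
reducedElems : ∀ {n m} → SetSystem n m → (Fin n → ℕ) → Subset m → Subset n
reducedElems S r F = tabulate (λ e → not (lookup (covered S r F) e))

reducedSets : ∀ {n m} → SetSystem n m → (Fin n → ℕ) → Subset m → SetSystem n m
reducedSets S r F j = tabulate (λ e → lookup (S j) e ∧ lookup (reducedElems S r F) e)

reducedReq : ∀ {n m} → SetSystem n m → (Fin n → ℕ) → Subset m → Fin n → ℕ
reducedReq S r F e = r e ℕ.∸ mult S F e

reducedCovered : ∀ {n m} → SetSystem n m → (Fin n → ℕ) → Subset m → Subset m → Subset n
reducedCovered S r F R =
  tabulate (λ e → lookup (reducedElems S r F) e
                ∧ lookup (covered (reducedSets S r F) (reducedReq S r F) R) e)

qPrime : ∀ {n m} → .{{ℕ.NonZero n}} → SetSystem n m → (Fin n → ℕ) → ℚ → Subset m → ℚ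
qPrime {n} S r q F = (q * ⟦ n ⟧ - ⟦ ∣ covered S r F ∣ ⟧) * (+ 1 / n)

-- R is the output of an α-approximation algorithm for MDSC on the reduced
-- instance w.r.t. F: R covers at least one element of the reduced instance,
-- and its density is at most α times the density of every sub-collection T
-- (with nonempty coverage) of the reduced instance.
IsApproxMDSC : ∀ {n m} → SetSystem n m → (Fin n → ℕ) → (Fin m → ℚ) → ℚ →
               Subset m → Subset m → Set
IsApproxMDSC {n} {m} S r c α F R =
  Σ (0 ℕ.< ∣ reducedCovered S r F R ∣) λ posR →
    (T : Subset m) (posT : 0 ℕ.< ∣ reducedCovered S r F T ∣) →
      (density (cost c R) ∣ reducedCovered S r F R ∣ {{ℕ.>-nonZero posR}})
        ≤ α * (density (cost c T) ∣ reducedCovered S r F T ∣ {{ℕ.>-nonZero posT}})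

-- ℱ after k iterations: ℛ_1 ∪ … ∪ ℛ_k  (ℛ is indexed from 1).
chosen : ∀ {m} → (ℕ → Subset m) → ℕ → Subset m
chosen R zero    = ⊥
chosen R (suc k) = chosen R k ∪ R (suc k)

-- ℛ_1,…,ℛ_t is an execution of Algorithm 1 with exactly t loop iterations:
-- before each iteration i (1 ≤ i ≤ t) the loop test q' > εq holds for
-- ℱ = ℛ_1 ∪ … ∪ ℛ_{i−1} and ℛ_i is an α-approximate MDSC solution of the
-- reduced instance; after iteration t the loop test fails.
IsRun : ∀ {n m} → .{{ℕ.NonZero n}} → SetSystem n m → (Fin n → ℕ) → (Fin m → ℚ) →
        (q ε α : ℚ) → (t : ℕ) → (ℕ → Subset m) → Set
IsRun S r c q ε α t R =
  ((i : ℕ) → 1 ℕ.≤ i → i ℕ.≤ t →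
     (ε * q < qPrime S r q (chosen R (ℕ.pred i)))
     × IsApproxMDSC S r c α (chosen R (ℕ.pred i)) (R i))
  × ¬ (ε * q < qPrime S r q (chosen R t))

Feasible : ∀ {n m} → SetSystem n m → (Fin n → ℕ) → ℚ → Subset m → Set
Feasible {n} S r q F = q * ⟦ n ⟧ ≤ ⟦ ∣ covered S r F ∣ ⟧

IsOptimal : ∀ {n m} → SetSystem n m → (Fin n → ℕ) → (Fin m → ℚ) → ℚ → Subset m → Set
IsOptimal {n} {m} S r c q O = Feasible S r q O × ((T : Subset m) → Feasible S r q T → cost c O ≤ cost c T)

-- Let ℱ = ℛ₁ ∪ … ∪ ℛₜ₋₁ and g = qn − |𝒞(ℱ)|. The loop test before the last iteration says
-- g > εqn. An optimal O covers at least qn elements, hence at least g elements of the reduced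
-- instance, while ℛₜ covers at most n − |𝒞(ℱ)| = g + (1 − q)n ≤ (1 + (1 − q)/(εq)) g of them.
-- The α-approximation compares the densities of ℛₜ and O, and this ratio of covered counts
-- turns that comparison into c(ℛₜ) ≤ α (1 + (1 − q)/(εq)) c(O).
module Submission where

open import Defs
open import Data.Bool using (Bool; true; false; not; T; _∧_; if_then_else_)
open import Data.Bool.Properties using (T-≡; T-∧; ∧-identityʳ)
open import Data.Nat as ℕ using (ℕ; zero; suc; z≤n; s≤s)
import Data.Nat.Properties as ℕ
open import Data.Fin using (Fin; zero; suc)
open import Data.Fin.Subset using (Subset; _∈_; _⊆_; _∪_; ∁; ∣_∣; inside; outside)
open import Data.Fin.Subset.Properties
  using (_∈?_; x∈p∪q⁺; x∉p⇒x∈∁p; p⊆q⇒∣p∣≤∣q∣; ∣∁p∣≡n∸∣p∣; ∣p∣≤n; ∣p∣≤∣x∷p∣)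
open import Data.Vec using ([]; _∷_; tabulate; lookup; map; foldr)
open import Data.Vec.Properties
  using ([]=⇒lookup; lookup⇒[]=; lookup∘tabulate; tabulate∘lookup; tabulate-∘; tabulate-cong)
open import Data.Integer as ℤ using (+_)
import Data.Integer.Properties as ℤ
open import Data.Integer.Tactic.RingSolver using (solve-∀)
open import Data.Rational as ℚ
  using (ℚ; 0ℚ; 1ℚ; _+_; _*_; _-_; _÷_; _/_; _≤_; _<_; -_; 1/_; >-nonZero; toℚᵘ;
         NonZero; Positive; positive; nonNegative)
open import Data.Rational.Properties
open import Data.Rational.Solver using (module +-*-Solver)
open import Data.Rational.Unnormalised as ℚᵘ using (mkℚᵘ; *≡*; *≤*)
import Data.Rational.Unnormalised.Properties as ℚᵘ
open import Data.Product using (_×_; _,_; proj₁; proj₂)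
open import Data.Product.Function.NonDependent.Propositional using (_×-⇔_)
open import Data.Sum using (inj₁; inj₂)
open import Data.Unit using (tt)
open import Function using (_∘_; const)
open import Function.Bundles using (_⇔_; mk⇔; Equivalence)
import Function.Properties.Equivalence as ⇔
open import Relation.Nullary using (Dec; yes; no; does; contradiction)
open import Relation.Binary.PropositionalEquality

open Equivalence using (to; from)
open +-*-Solver using (solve; _:+_; _:*_; _:-_; _:=_; con)

toℚᵘ-⟦⟧ : ∀ k → toℚᵘ ⟦ k ⟧ ℚᵘ.≃ mkℚᵘ (+ k) 0
toℚᵘ-⟦⟧ k = toℚᵘ-fromℚᵘ (mkℚᵘ (+ k) 0)

⟦⟧-homo-+ : ∀ a b → ⟦ a ℕ.+ b ⟧ ≡ ⟦ a ⟧ + ⟦ b ⟧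
⟦⟧-homo-+ a b = toℚᵘ-injective (begin
  toℚᵘ ⟦ a ℕ.+ b ⟧                       ≈⟨ toℚᵘ-⟦⟧ (a ℕ.+ b) ⟩
  mkℚᵘ (+ (a ℕ.+ b)) 0                   ≈⟨ *≡* (sum-over-one (+ a) (+ b)) ⟩
  mkℚᵘ (+ a) 0 ℚᵘ.+ mkℚᵘ (+ b) 0         ≈⟨ ℚᵘ.+-cong (toℚᵘ-⟦⟧ a) (toℚᵘ-⟦⟧ b) ⟨
  toℚᵘ ⟦ a ⟧ ℚᵘ.+ toℚᵘ ⟦ b ⟧             ≈⟨ toℚᵘ-homo-+ ⟦ a ⟧ ⟦ b ⟧ ⟨
  toℚᵘ (⟦ a ⟧ + ⟦ b ⟧)                   ∎)
  where
  open ℚᵘ.≃-Reasoning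
  sum-over-one : ∀ x y → (x ℤ.+ y) ℤ.* ((+ 1) ℤ.* (+ 1)) ≡ (x ℤ.* + 1 ℤ.+ y ℤ.* + 1) ℤ.* + 1
  sum-over-one = solve-∀

⟦⟧-mono-≤ : ∀ {a b} → a ℕ.≤ b → ⟦ a ⟧ ≤ ⟦ b ⟧
⟦⟧-mono-≤ {a} {b} a≤b = toℚᵘ-cancel-≤ (ℚᵘ.≤-respˡ-≃ (ℚᵘ.≃-sym (toℚᵘ-⟦⟧ a))
  (ℚᵘ.≤-respʳ-≃ (ℚᵘ.≃-sym (toℚᵘ-⟦⟧ b))
    (*≤* (subst₂ ℤ._≤_ (sym (ℤ.*-identityʳ (+ a))) (sym (ℤ.*-identityʳ (+ b))) (ℤ.+≤+ a≤b)))))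

1/k*⟦k⟧≡1 : ∀ k .{{_ : ℕ.NonZero k}} → (+ 1 / k) * ⟦ k ⟧ ≡ 1ℚ
1/k*⟦k⟧≡1 (suc k) = toℚᵘ-injective (begin
  toℚᵘ ((+ 1 / suc k) * ⟦ suc k ⟧)          ≈⟨ toℚᵘ-homo-* (+ 1 / suc k) ⟦ suc k ⟧ ⟩
  toℚᵘ (+ 1 / suc k) ℚᵘ.* toℚᵘ ⟦ suc k ⟧    ≈⟨ ℚᵘ.*-cong (toℚᵘ-fromℚᵘ (mkℚᵘ (+ 1) k)) (toℚᵘ-⟦⟧ (suc k)) ⟩
  mkℚᵘ (+ 1) k ℚᵘ.* mkℚᵘ (+ suc k) 0        ≈⟨ *≡* (cancel (+ suc k)) ⟩
  ℚᵘ.1ℚᵘ                                    ∎)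
  where
  open ℚᵘ.≃-Reasoning
  cancel : ∀ d → (+ 1 ℤ.* d) ℤ.* + 1 ≡ + 1 ℤ.* (d ℤ.* + 1)
  cancel = solve-∀

x/k*k≡x : ∀ x k .{{_ : ℕ.NonZero k}} → x * (+ 1 / k) * ⟦ k ⟧ ≡ x
x/k*k≡x x k = begin
  x * (+ 1 / k) * ⟦ k ⟧    ≡⟨ *-assoc x (+ 1 / k) ⟦ k ⟧ ⟩
  x * ((+ 1 / k) * ⟦ k ⟧)  ≡⟨ cong (x *_) (1/k*⟦k⟧≡1 k) ⟩
  x * 1ℚ                   ≡⟨ *-identityʳ x ⟩
  x                        ∎
  where open ≡-Reasoning

⟦⟧-positive : ∀ k .{{_ : ℕ.NonZero k}} → Positive ⟦ k ⟧
⟦⟧-positive k = normalize-pos k 1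

⟦⟧-positive⁻¹ : ∀ {k} → 0ℚ < ⟦ k ⟧ → 0 ℕ.< k
⟦⟧-positive⁻¹ {zero}  0<0 = contradiction 0<0 (<-irrefl refl)
⟦⟧-positive⁻¹ {suc k} _   = ℕ.z<s

x<y/k⇒x*k<y : ∀ {x y} k .{{_ : ℕ.NonZero k}} → x < y * (+ 1 / k) → x * ⟦ k ⟧ < y
x<y/k⇒x*k<y {x} {y} k x<y/k = subst (x * ⟦ k ⟧ <_) (x/k*k≡x y k) (*-monoˡ-<-pos ⟦ k ⟧ {{⟦⟧-positive k}} x<y/k)

∣p∪q∣≤∣p∣+∣q∣ : ∀ {n} (p q : Subset n) → ∣ p ∪ q ∣ ℕ.≤ ∣ p ∣ ℕ.+ ∣ q ∣
∣p∪q∣≤∣p∣+∣q∣ []            []            = z≤n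
∣p∪q∣≤∣p∣+∣q∣ (outside ∷ p) (outside ∷ q) = ∣p∪q∣≤∣p∣+∣q∣ p q
∣p∪q∣≤∣p∣+∣q∣ (outside ∷ p) (inside  ∷ q) =
  ℕ.≤-trans (s≤s (∣p∪q∣≤∣p∣+∣q∣ p q)) (ℕ.≤-reflexive (sym (ℕ.+-suc ∣ p ∣ ∣ q ∣)))
∣p∪q∣≤∣p∣+∣q∣ (inside  ∷ p) (t       ∷ q) =
  s≤s (ℕ.≤-trans (∣p∪q∣≤∣p∣+∣q∣ p q) (ℕ.+-monoʳ-≤ ∣ p ∣ (∣p∣≤∣x∷p∣ t q)))

∈⇔T-lookup : ∀ {n} {p : Subset n} {x} → x ∈ p ⇔ T (lookup p x)
∈⇔T-lookup {p = p} {x} = mk⇔ (from T-≡ ∘ []=⇒lookup) (lookup⇒[]= x p ∘ to T-≡)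

∈-tabulate : ∀ {n} {f : Fin n → Bool} {x} → x ∈ tabulate f ⇔ T (f x)
∈-tabulate {f = f} {x} = mk⇔
  (subst T (lookup∘tabulate f x) ∘ to ∈⇔T-lookup)
  (from ∈⇔T-lookup ∘ subst T (sym (lookup∘tabulate f x)))

T-does : ∀ {P : Set} (P? : Dec P) → T (does P?) ⇔ P
T-does (yes p) = mk⇔ (const p) (const tt)
T-does (no ¬p) = mk⇔ (λ ()) ¬p

module _ {n m} (S : SetSystem n m) (r : Fin n → ℕ) where

  ∈-covered : ∀ F {x} → x ∈ covered S r F ⇔ r x ℕ.≤ mult S F x
  ∈-covered F {x} = ⇔.trans ∈-tabulate (T-does (r x ℕ.≤? mult S F x))

module _ {n m} (S : SetSystem n m) (r : Fin n → ℕ) (F : Subset m) where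

  reducedElems≡∁covered : reducedElems S r F ≡ ∁ (covered S r F)
  reducedElems≡∁covered =
    trans (tabulate-∘ not (lookup (covered S r F))) (cong (map not) (tabulate∘lookup _))

  mult-reducedSets : ∀ {x} (O : Subset m) → x ∈ reducedElems S r F →
                     mult (reducedSets S r F) O x ≡ mult S O x
  mult-reducedSets {x} O x∈E′ = cong ∣_∣ (tabulate-cong λ j → cong (lookup O j ∧_) (begin
    lookup (reducedSets S r F j) x                   ≡⟨ lookup∘tabulate _ x ⟩
    lookup (S j) x ∧ lookup (reducedElems S r F) x  ≡⟨ cong (lookup (S j) x ∧_) (to T-≡ (to ∈⇔T-lookup x∈E′)) ⟩
    lookup (S j) x ∧ true                            ≡⟨ ∧-identityʳ _ ⟩
    lookup (S j) x                                   ∎))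
    where open ≡-Reasoning

  ∈-reducedCovered : ∀ R {x} → x ∈ reducedCovered S r F R ⇔
                     (x ∈ reducedElems S r F × x ∈ covered (reducedSets S r F) (reducedReq S r F) R)
  ∈-reducedCovered R = ⇔.trans ∈-tabulate (⇔.trans T-∧ (⇔.sym ∈⇔T-lookup ×-⇔ ⇔.sym ∈⇔T-lookup))

  reducedCovered⊆∁covered : ∀ R → reducedCovered S r F R ⊆ ∁ (covered S r F)
  reducedCovered⊆∁covered R x∈ = subst (_ ∈_) reducedElems≡∁covered (proj₁ (to (∈-reducedCovered R) x∈))

  covered⊆covered∪reducedCovered : ∀ O → covered S r O ⊆ covered S r F ∪ reducedCovered S r F O
  covered⊆covered∪reducedCovered O {x} x∈𝒞O with x ∈? covered S r F
  ... | yes x∈𝒞F = x∈p∪q⁺ (inj₁ x∈𝒞F)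
  ... | no  x∉𝒞F = x∈p∪q⁺ (inj₂ (from (∈-reducedCovered O)
                     (x∈E′ , from (∈-covered (reducedSets S r F) (reducedReq S r F) O) r′≤)))
    where
    x∈E′ : x ∈ reducedElems S r F
    x∈E′ = subst (x ∈_) (sym reducedElems≡∁covered) (x∉p⇒x∈∁p x∉𝒞F)
    r′≤ : reducedReq S r F x ℕ.≤ mult (reducedSets S r F) O x
    r′≤ = ℕ.≤-trans (ℕ.m∸n≤m (r x) (mult S F x))
            (subst (r x ℕ.≤_) (sym (mult-reducedSets O x∈E′)) (to (∈-covered S r O) x∈𝒞O))

  ∣reducedCovered∣+∣covered∣≤n : ∀ R → ∣ reducedCovered S r F R ∣ ℕ.+ ∣ covered S r F ∣ ℕ.≤ n
  ∣reducedCovered∣+∣covered∣≤n R = begin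
    ∣ reducedCovered S r F R ∣ ℕ.+ ∣ 𝒞F ∣  ≤⟨ ℕ.+-monoˡ-≤ ∣ 𝒞F ∣ (p⊆q⇒∣p∣≤∣q∣ (reducedCovered⊆∁covered R)) ⟩
    ∣ ∁ 𝒞F ∣ ℕ.+ ∣ 𝒞F ∣                    ≡⟨ cong (ℕ._+ ∣ 𝒞F ∣) (∣∁p∣≡n∸∣p∣ 𝒞F) ⟩
    n ℕ.∸ ∣ 𝒞F ∣ ℕ.+ ∣ 𝒞F ∣                ≡⟨ ℕ.m∸n+n≡m (∣p∣≤n 𝒞F) ⟩
    n                                       ∎
    where
    open ℕ.≤-Reasoning
    𝒞F = covered S r F

  ∣covered∣≤∣covered∣+∣reducedCovered∣ : ∀ O →
    ∣ covered S r O ∣ ℕ.≤ ∣ covered S r F ∣ ℕ.+ ∣ reducedCovered S r F O ∣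
  ∣covered∣≤∣covered∣+∣reducedCovered∣ O =
    ℕ.≤-trans (p⊆q⇒∣p∣≤∣q∣ (covered⊆covered∪reducedCovered O))
              (∣p∪q∣≤∣p∣+∣q∣ (covered S r F) (reducedCovered S r F O))

  Feasible⇒≤covered+reducedCovered : ∀ q O → Feasible S r q O →
    q * ⟦ n ⟧ ≤ ⟦ ∣ covered S r F ∣ ⟧ + ⟦ ∣ reducedCovered S r F O ∣ ⟧
  Feasible⇒≤covered+reducedCovered q O O-feasible = begin
    q * ⟦ n ⟧                                              ≤⟨ O-feasible ⟩
    ⟦ ∣ covered S r O ∣ ⟧                                  ≤⟨ ⟦⟧-mono-≤ (∣covered∣≤∣covered∣+∣reducedCovered∣ O) ⟩
    ⟦ ∣ covered S r F ∣ ℕ.+ ∣ reducedCovered S r F O ∣ ⟧  ≡⟨ ⟦⟧-homo-+ ∣ covered S r F ∣ _ ⟩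
    ⟦ ∣ covered S r F ∣ ⟧ + ⟦ ∣ reducedCovered S r F O ∣ ⟧ ∎
    where open ≤-Reasoning

density-nonNeg : ∀ {x} k .{{_ : ℕ.NonZero k}} → 0ℚ ≤ x → 0ℚ ≤ density x k
density-nonNeg {x} k 0≤x = nonNegative⁻¹ _
  {{nonNeg*nonNeg⇒nonNeg x {{nonNegative 0≤x}} (+ 1 / k) {{normalize-nonNeg 1 k}}}}

foldr-+-nonNeg : ∀ {m} (g : Fin m → ℚ) → (∀ j → 0ℚ ≤ g j) → 0ℚ ≤ foldr _ _+_ 0ℚ (tabulate g)
foldr-+-nonNeg {zero}  g 0≤g = ≤-refl
foldr-+-nonNeg {suc m} g 0≤g =
  +-mono-≤ (0≤g zero) (foldr-+-nonNeg (λ j → g (suc j)) (λ j → 0≤g (suc j)))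

cost-nonNeg : ∀ {m} (c : Fin m → ℚ) → (∀ j → 0ℚ ≤ c j) → ∀ F → 0ℚ ≤ cost c F
cost-nonNeg c 0≤c F = foldr-+-nonNeg _ λ j → selected-nonNeg (lookup F j) j
  where
  selected-nonNeg : ∀ b j → 0ℚ ≤ (if b then c j else 0ℚ)
  selected-nonNeg true  j = 0≤c j
  selected-nonNeg false j = ≤-refl

cost≤-from-density≤ : ∀ {x y α γ : ℚ} k l .{{_ : ℕ.NonZero k}} .{{_ : ℕ.NonZero l}} →
                      0ℚ ≤ x → density x k ≤ α * density y l → ⟦ k ⟧ ≤ γ * ⟦ l ⟧ →
                      x ≤ α * γ * y
cost≤-from-density≤ {x} {y} {α} {γ} k l 0≤x dx≤αdy k≤γl = begin
  x                             ≡⟨ x/k*k≡x x k ⟨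
  density x k * ⟦ k ⟧           ≤⟨ *-monoʳ-≤-nonNeg ⟦ k ⟧ {{pos⇒nonNeg ⟦ k ⟧ {{⟦⟧-positive k}}}} dx≤αdy ⟩
  α * density y l * ⟦ k ⟧       ≤⟨ *-monoˡ-≤-nonNeg (α * density y l) {{nonNegative 0≤αdy}} k≤γl ⟩
  α * density y l * (γ * ⟦ l ⟧) ≡⟨ solve 5 (λ α y i g l → α :* (y :* i) :* (g :* l) := α :* g :* (y :* i :* l))
                                           refl α y (+ 1 / l) γ ⟦ l ⟧ ⟩
  α * γ * (density y l * ⟦ l ⟧) ≡⟨ cong (α * γ *_) (x/k*k≡x y l) ⟩
  α * γ * y                     ∎
  where
  open ≤-Reasoning
  0≤αdy : 0ℚ ≤ α * density y l
  0≤αdy = ≤-trans (density-nonNeg k 0≤x) dx≤αdy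

÷-÷-*-cancel : ∀ x a b .{{_ : NonZero a}} .{{_ : NonZero b}} → x ÷ a ÷ b * (a * b) ≡ x
÷-÷-*-cancel x a b = begin
  x * 1/ a * 1/ b * (a * b)       ≡⟨ solve 5 (λ x a b ia ib → x :* ia :* ib :* (a :* b) := x :* (a :* ia) :* (b :* ib))
                                          refl x a b (1/ a) (1/ b) ⟩
  x * (a * 1/ a) * (b * 1/ b)     ≡⟨ cong₂ (λ s t → x * s * t) (*-inverseʳ a) (*-inverseʳ b) ⟩
  x * 1ℚ * 1ℚ                     ≡⟨ solve 1 (λ x → x :* con 1ℚ :* con 1ℚ := x) refl x ⟩
  x                               ∎
  where open ≡-Reasoning

÷-nonNeg : ∀ {x p} → 0ℚ ≤ x → (0<p : 0ℚ < p) → 0ℚ ≤ (x ÷ p) {{>-nonZero 0<p}}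
÷-nonNeg {x} {p} 0≤x 0<p = nonNegative⁻¹ (x * 1/p)
  {{nonNeg*nonNeg⇒nonNeg x {{nonNegative 0≤x}} 1/p {{pos⇒nonNeg 1/p {{1/pos⇒pos p {{positive 0<p}}}}}}}}
  where
  1/p : ℚ
  1/p = (1/ p) {{>-nonZero 0<p}}

p≤q⇒0≤q-p : ∀ {p q} → p ≤ q → 0ℚ ≤ q - p
p≤q⇒0≤q-p {p} {q} p≤q = begin
  0ℚ     ≡⟨ +-inverseʳ p ⟨
  p - p  ≤⟨ +-monoˡ-≤ (- p) p≤q ⟩
  q - p  ∎
  where open ≤-Reasoning

p+r≤q⇒p≤q-r : ∀ {p q r} → p + r ≤ q → p ≤ q - r
p+r≤q⇒p≤q-r {p} {q} {r} p+r≤q = begin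
  p          ≡⟨ solve 2 (λ p r → p := p :+ r :- r) refl p r ⟩
  p + r - r  ≤⟨ +-monoˡ-≤ (- r) p+r≤q ⟩
  q - r      ∎
  where open ≤-Reasoning

p≤r+q⇒p-r≤q : ∀ {p q r} → p ≤ r + q → p - r ≤ q
p≤r+q⇒p-r≤q {p} {q} {r} p≤r+q = begin
  p - r      ≤⟨ +-monoˡ-≤ (- r) p≤r+q ⟩
  r + q - r  ≡⟨ solve 2 (λ q r → r :+ q :- r := q) refl q r ⟩
  q          ∎
  where open ≤-Reasoning

growth : (q ε : ℚ) → 0ℚ < q → 0ℚ < ε → ℚ
growth q ε 0<q 0<ε = 1ℚ + (((1ℚ - q) ÷ ε) {{>-nonZero 0<ε}} ÷ q) {{>-nonZero 0<q}}

≤-growth* : ∀ {q ε N C K L} (0<q : 0ℚ < q) (0<ε : 0ℚ < ε) → q ≤ 1ℚ →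
            ε * q * N ≤ q * N - C → q * N ≤ C + K → L + C ≤ N →
            L ≤ growth q ε 0<q 0<ε * K
≤-growth* {q} {ε} {N} {C} {K} {L} 0<q 0<ε q≤1 εqN≤G qN≤C+K L+C≤N = begin
  L                                ≤⟨ p+r≤q⇒p≤q-r L+C≤N ⟩
  N - C                            ≡⟨ solve 3 (λ N C q → N :- C := (q :* N :- C) :+ (con 1ℚ :- q) :* N) refl N C q ⟩
  G + (1ℚ - q) * N                 ≡⟨ cong (λ z → G + z * N) (÷-÷-*-cancel (1ℚ - q) ε q) ⟨
  G + u * (ε * q) * N              ≡⟨ cong (λ z → G + z) (*-assoc u (ε * q) N) ⟩
  G + u * (ε * q * N)              ≤⟨ +-monoʳ-≤ G (*-monoˡ-≤-nonNeg u {{nonNegative 0≤u}} εqN≤G) ⟩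
  G + u * G                        ≡⟨ solve 2 (λ G u → G :+ u :* G := (con 1ℚ :+ u) :* G) refl G u ⟩
  (1ℚ + u) * G                     ≤⟨ *-monoˡ-≤-nonNeg (1ℚ + u) {{nonNegative 0≤1+u}} (p≤r+q⇒p-r≤q qN≤C+K) ⟩
  (1ℚ + u) * K                     ∎
  where
  open ≤-Reasoning
  instance
    _ : NonZero ε
    _ = >-nonZero 0<ε
    _ : NonZero q
    _ = >-nonZero 0<q
  G = q * N - C
  u = (1ℚ - q) ÷ ε ÷ q
  0≤u : 0ℚ ≤ u
  0≤u = ÷-nonNeg (÷-nonNeg (p≤q⇒0≤q-p q≤1) 0<ε) 0<q
  0≤1+u : 0ℚ ≤ 1ℚ + u
  0≤1+u = +-mono-≤ (<⇒≤ (positive⁻¹ 1ℚ)) 0≤u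

lemma2 : (n : ℕ) .{{_ : ℕ.NonZero n}} (m : ℕ)
         (S : SetSystem n m) (c : Fin m → ℚ) (r : Fin n → ℕ) (q : ℚ) →
         ((j : Fin m) → 0ℚ ≤ c j) →
         ((e : Fin n) → 1 ℕ.≤ r e) →
         (0<q : 0ℚ < q) → q < 1ℚ →
         (ε : ℚ) (0<ε : 0ℚ < ε) → ε < 1ℚ →
         (α : ℚ) (t : ℕ) (R : ℕ → Subset m) →
         IsRun S r c q ε α t R →
         1 ℕ.≤ t →
         (O : Subset m) → IsOptimal S r c q O →
         cost c (R t)
           ≤ α * (1ℚ + ((((1ℚ - q) ÷ ε) {{ℚ.>-nonZero 0<ε}}) ÷ q) {{ℚ.>-nonZero 0<q}}) * cost c O
lemma2 n m S c r q 0≤c _ 0<q q<1 ε 0<ε _ α t R (iterations , _) 1≤t O (O-feasible , _) =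
  cost≤-from-density≤ {α = α} kR kO (cost-nonNeg c 0≤c (R t)) (R-approx O 0<kO)
    (≤-growth* 0<q 0<ε (<⇒≤ q<1) (<⇒≤ εqN<gap) qN≤C+kO kR+C≤N)
  where
  F = chosen R (ℕ.pred t)
  N = ⟦ n ⟧
  C = ⟦ ∣ covered S r F ∣ ⟧
  kR = ∣ reducedCovered S r F (R t) ∣
  kO = ∣ reducedCovered S r F O ∣
  last-iteration = iterations t 1≤t ℕ.≤-refl
  R-approx = proj₂ (proj₂ last-iteration)

  εqN<gap : ε * q * N < q * N - C
  εqN<gap = x<y/k⇒x*k<y n (proj₁ last-iteration)

  qN≤C+kO : q * N ≤ C + ⟦ kO ⟧
  qN≤C+kO = Feasible⇒≤covered+reducedCovered S r F q O O-feasible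

  kR+C≤N : ⟦ kR ⟧ + C ≤ N
  kR+C≤N = subst (_≤ N) (⟦⟧-homo-+ kR ∣ covered S r F ∣) (⟦⟧-mono-≤ (∣reducedCovered∣+∣covered∣≤n S r F (R t)))

  0<kO : 0 ℕ.< kO
  0<kO = ⟦⟧-positive⁻¹ (<-≤-trans (<-trans 0<εqN εqN<gap) (p≤r+q⇒p-r≤q qN≤C+kO))
    where
    0<εqN : 0ℚ < ε * q * N
    0<εqN = positive⁻¹ (ε * q * N)
      {{pos*pos⇒pos (ε * q) {{pos*pos⇒pos ε {{positive 0<ε}} q {{positive 0<q}}}} N {{⟦⟧-positive n}}}}

  instance
    _ : ℕ.NonZero kR
    _ = ℕ.>-nonZero (proj₁ (proj₂ last-iteration))
    _ : ℕ.NonZero kO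
    _ = ℕ.>-nonZero 0<kO
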